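{- A marked reachability graph sequence $\mathcal{U}=\mathcal{M}_0a_1\mathcal{M}_1\cdots a_k\mathcal{M}_k$, $\mathcal{M}_j=(\vec{m}_j,\vec{x}_j,G_j,\vec{x}_j',\vec{m}_j')$, $G_j=(Q_j,\Sigma,T_j)$, satisfies the large solution condition if and only if both: (i) its characteristic system has a solution with all components in $\mathbb{Z}$; and (ii) its homogeneous characteristic system has a solution $(\vec{s}_{0,j},\mu_{0,j},\vec{s}_{0,j}')_j$ with components in $\mathbb{Q}$ such that for every $j$: $\vec{s}_{0,j}[i]>0$ for every $i$ with $\vec{m}_j[i]=\top$, $\mu_{0,j}(t)>0$ for every $t\in T_j$, and $\vec{s}_{0,j}'[i]>0$ for every $i$ with $\vec{m}_j'[i]=\top$.
   Context: A VAS is $\mathcal{V}=(\Sigma,n,\delta)$, $\Sigma$ finite nonempty, $\delta:\Sigma\to\mathbb{Z}^n$. $\mathbb{N}_\top=\mathbb{N}\cup\{\top\}$ with $k<\top$, $\top+z=\top$; $\vec{x}\xrightarrow{a}_{\mathcal{V}}\vec{x}'$ iff $\vec{x},\vec{x}'\in\mathbb{N}_\top^n$ and $\vec{x}'=\vec{x}+\delta(a)$; $x_1\unlhd x_2$ iff $x_1=x_2$ or $x_2=\top$ (componentwise); $\lim$ of a non-decreasing sequence in $\mathbb{N}_\top$ is its least upper bound. A reachability graph is $G=(Q,\Sigma,T)$, $Q\subseteq\mathbb{N}_\top^n$ finite, $T\subseteq\{(q,a,q')\mid q\xrightarrow{a}_{\mathcal{V}}q'\}$. A marked reachability graph is $(\vec{m},\vec{x},G,\vec{x}',\vec{m}')$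 with $G$ strongly connected, $\vec{x},\vec{x}'\in Q$, $\vec{m}\unlhd\vec{x}$, $\vec{m}'\unlhd\vec{x}'$. An MRGS is an alternating sequence $\mathcal{M}_0a_1\mathcal{M}_1\cdots a_k\mathcal{M}_k$ of marked reachability graphs and letters $a_j\in\Sigma$. For a graph $G=(Q,\Sigma,T)$ and states $q,q'$, $\chi_{q,G,q'}(\mu)$ (for $\mu:T\to\mathbb{Q}$) is the system: for every $p\in Q$, $\sum_{t=(p_0,a,p)\in T}\mu(t)+e(q,p)=\sum_{t=(p,a,p_1)\in T}\mu(t)+e(p,q')$, where $e(u,v)=1$ if $u=v$, else $0$; $\chi_G$ denotes $\chi_{q,G,q}$ (independent of $q$). For $t=(q,a,q')$, $\delta(t)=\delta(a)$. The characteristic system of $\mathcal{U}$ has unknowns $\vec{s}_j,\vec{s}_j'\in\mathbb{Q}^n$, $\mu_j:T_j\to\mathbb{Q}$ and equations: $\vec{s}_{j-1}'+\delta(a_j)=\vec{s}_j$ ($1\leq j\leq k$); $\vec{s}_j+\sum_{t\in T_j}\mu_j(t)\delta(t)=\vec{s}_j'$; $\vec{s}_j[i]=\vec{m}_j[i]$ if $\vec{m}_j[i]\in\mathbb{N}$; $\vec{s}_j'[i]=\vec{m}_j'[i]$ if $\vec{m}_j'[i]\in\mathbb{N}$; $\chi_{\vec{x}_j,G_j,\vec{x}_j'}(\mu_j)$. The homogeneous characteristic system has unknowns $\vec{s}_{0,j},\vec{s}_{0,j}',\mu_{0,j}$ and equations: $\vec{s}_{0,j-1}'=\vec{s}_{0,j}$;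 $\vec{s}_{0,j}+\sum_{t\in T_j}\mu_{0,j}(t)\delta(t)=\vec{s}_{0,j}'$; $\vec{s}_{0,j}[i]=0$ if $\vec{m}_j[i]\in\mathbb{N}$; $\vec{s}_{0,j}'[i]=0$ if $\vec{m}_j'[i]\in\mathbb{N}$; $\chi_{G_j}(\mu_{0,j})$. $\mathcal{U}$ satisfies the large solution condition if there is a componentwise non-decreasing sequence $(\vec{\xi}_c)_{c\in\mathbb{N}}$, $\vec{\xi}_c=(\vec{s}_{j,c},\mu_{j,c},\vec{s}_{j,c}')_j$, of solutions with components in $\mathbb{N}$ of the characteristic system such that for all $j$: $\lim_c\vec{s}_{j,c}=\vec{m}_j$ (componentwise), $\lim_c\mu_{j,c}(t)=\top$ for all $t\in T_j$, and $\lim_c\vec{s}_{j,c}'=\vec{m}_j'$. -}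

module Defs where

open import Data.Nat as ℕ using (ℕ; zero; suc)
open import Data.Integer as ℤ using (ℤ; +_)
open import Data.Rational as ℚ using (ℚ; 0ℚ; 1ℚ; _/_)
open import Data.Fin using (Fin; zero; suc; _≟_)
open import Data.Vec using (Vec; lookup)
open import Data.Product using (Σ; ∃; _×_; _,_; proj₁; proj₂)
open import Relation.Nullary.Decidable using (⌊_⌋)
open import Data.Bool using (if_then_else_)
open import Relation.Binary.PropositionalEquality using (_≡_)
open import Function.Definitions using (Injective)

data ℕ⊤ : Set where
  fin : ℕ → ℕ⊤
  top : ℕ⊤

-- x' = x + z in ℕ⊤ (with ⊤ + z = ⊤), where the result must lie in ℕ⊤
data AddStep : ℕ⊤ → ℤ → ℕ⊤ → Set where
  top-step : ∀ {z} → AddStep top z top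
  fin-step : ∀ {k z k'} → + k' ≡ (+ k) ℤ.+ z → AddStep (fin k) z (fin k')

data _⊴_ : ℕ⊤ → ℕ⊤ → Set where
  ⊴-refl : ∀ {x} → x ⊴ x
  ⊴-top  : ∀ {x} → x ⊴ top

_⊴ᵛ_ : ∀ {n} → Vec ℕ⊤ n → Vec ℕ⊤ n → Set
m ⊴ᵛ x = ∀ i → lookup m i ⊴ lookup x i

record VAS : Set where
  field
    σ        : ℕ                 -- Σ = Fin σ
    nonempty : ℕ.NonZero σ
    n        : ℕ
    δ        : Fin σ → Vec ℤ n

sumℚ : ∀ {m} → (Fin m → ℚ) → ℚ
sumℚ {zero}  f = 0ℚ
sumℚ {suc m} f = f zero ℚ.+ sumℚ (λ i → f (suc i))

ℤ→ℚ : ℤ → ℚ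
ℤ→ℚ z = z / 1

ℕ→ℚ : ℕ → ℚ
ℕ→ℚ k = (+ k) / 1

e : ∀ {m} → Fin m → Fin m → ℚ
e u v = if ⌊ u ≟ v ⌋ then 1ℚ else 0ℚ


module _ (V : VAS) where
  open VAS V

  StepV : Vec ℕ⊤ n → Fin σ → Vec ℕ⊤ n → Set
  StepV x a x' = ∀ i → AddStep (lookup x i) (lookup (δ a) i) (lookup x' i)

  -- Reachability graph G = (Q, Σ, T): Q and T are finite sets, given by
  -- injective enumerations Fin nQ → states and Fin nT → transitions.
  record RGraph : Set where
    field
      nQ    : ℕ
      Q     : Fin nQ → Vec ℕ⊤ n
      Q-inj : Injective _≡_ _≡_ Q
      nT    : ℕ
      T     : Fin nT → Fin nQ × Fin σ × Fin nQ   -- (source, letter, target)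
      T-inj : Injective _≡_ _≡_ T
      T-ok  : ∀ t → StepV (Q (proj₁ (T t))) (proj₁ (proj₂ (T t))) (Q (proj₂ (proj₂ (T t))))

    src : Fin nT → Fin nQ
    src t = proj₁ (T t)
    lab : Fin nT → Fin σ
    lab t = proj₁ (proj₂ (T t))
    tgt : Fin nT → Fin nQ
    tgt t = proj₂ (proj₂ (T t))

  open RGraph public

  data Path (G : RGraph) : Fin (nQ G) → Fin (nQ G) → Set where
    here : ∀ {p} → Path G p p
    step : ∀ {q} (t : Fin (nT G)) → Path G (tgt G t) q → Path G (src G t) q

  StronglyConnected : RGraph → Set
  StronglyConnected G = ∀ p q → Path G p q

  record MRG : Set where
    field
      G     : RGraph
      scc   : StronglyConnected G
      x     : Fin (nQ G)
      x'    : Fin (nQ G)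
      m     : Vec ℕ⊤ n
      m'    : Vec ℕ⊤ n
      m⊴x   : m ⊴ᵛ Q G x
      m'⊴x' : m' ⊴ᵛ Q G x'

  record MRGS : Set where
    field
      k  : ℕ
      M  : Fin (suc k) → MRG
      a  : Fin k → Fin σ

  open MRG public
  open MRGS public

  χ : (G : RGraph) → Fin (nQ G) → Fin (nQ G) → (Fin (nT G) → ℚ) → Set
  χ G q q' μ = ∀ (p : Fin (nQ G)) →
    sumℚ (λ t → if ⌊ tgt G t ≟ p ⌋ then μ t else 0ℚ) ℚ.+ e q p
      ≡ sumℚ (λ t → if ⌊ src G t ≟ p ⌋ then μ t else 0ℚ) ℚ.+ e p q'

  effect : (G : RGraph) → (Fin (nT G) → ℚ) → Fin n → ℚ
  effect G μ i = sumℚ (λ t → μ t ℚ.* ℤ→ℚ (lookup (δ (lab G t)) i))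

  record Assignment (U : MRGS) (R : Set) : Set where
    field
      s  : Fin (suc (k U)) → Fin n → R
      μ  : (j : Fin (suc (k U))) → Fin (nT (G (M U j))) → R
      s' : Fin (suc (k U)) → Fin n → R

  open Assignment public

  mapA : ∀ {U R R'} → (R → R') → Assignment U R → Assignment U R'
  mapA f A = record
    { s  = λ j i → f (s A j i)
    ; μ  = λ j t → f (μ A j t)
    ; s' = λ j i → f (s' A j i) }

  -- consecutive indices j-1, j  (for 1 ≤ j ≤ k) written as inject₁ j', suc j'
  open import Data.Fin using (inject₁)

  IsCharSol : (U : MRGS) → Assignment U ℚ → Set
  IsCharSol U A =
      (∀ (j : Fin (k U)) (i : Fin n) →
         s' A (inject₁ j) i ℚ.+ ℤ→ℚ (lookup (δ (a U j)) i) ≡ s A (suc j) i)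
    × (∀ j i → s A j i ℚ.+ effect (G (M U j)) (μ A j) i ≡ s' A j i)
    × (∀ j i v → lookup (m (M U j)) i ≡ fin v → s A j i ≡ ℕ→ℚ v)
    × (∀ j i v → lookup (m' (M U j)) i ≡ fin v → s' A j i ≡ ℕ→ℚ v)
    × (∀ j → χ (G (M U j)) (x (M U j)) (x' (M U j)) (μ A j))

  IsHomSol : (U : MRGS) → Assignment U ℚ → Set
  IsHomSol U A =
      (∀ (j : Fin (k U)) (i : Fin n) → s' A (inject₁ j) i ≡ s A (suc j) i)
    × (∀ j i → s A j i ℚ.+ effect (G (M U j)) (μ A j) i ≡ s' A j i)
    × (∀ j i v → lookup (m (M U j)) i ≡ fin v → s A j i ≡ 0ℚ)
    × (∀ j i v → lookup (m' (M U j)) i ≡ fin v → s' A j i ≡ 0ℚ)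
    -- χ_{G_j} = χ_{q,G_j,q}, instantiated with q = x_j (independent of q)
    × (∀ j → χ (G (M U j)) (x (M U j)) (x (M U j)) (μ A j))

  Positive : (U : MRGS) → Assignment U ℚ → Set
  Positive U A =
      (∀ j i → lookup (m (M U j)) i ≡ top → 0ℚ ℚ.< s A j i)
    × (∀ j t → 0ℚ ℚ.< μ A j t)
    × (∀ j i → lookup (m' (M U j)) i ≡ top → 0ℚ ℚ.< s' A j i)

  _≤A_ : ∀ {U} → Assignment U ℕ → Assignment U ℕ → Set
  A ≤A B = (∀ j i → s A j i ℕ.≤ s B j i)
         × (∀ j t → μ A j t ℕ.≤ μ B j t)
         × (∀ j i → s' A j i ℕ.≤ s' B j i)

  -- lim of a non-decreasing ℕ-sequence (its least upper bound in ℕ⊤)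
  Lim : (ℕ → ℕ) → ℕ⊤ → Set
  Lim f (fin v) = (∀ c → f c ℕ.≤ v) × ∃ λ c → f c ≡ v
  Lim f top     = ∀ b → ∃ λ c → b ℕ.≤ f c

  LargeSolutionCondition : MRGS → Set
  LargeSolutionCondition U =
    Σ (ℕ → Assignment U ℕ) λ ξ →
        (∀ c → IsCharSol U (mapA ℕ→ℚ (ξ c)))
      × (∀ c → ξ c ≤A ξ (suc c))
      × (∀ j i → Lim (λ c → s (ξ c) j i) (lookup (m (M U j)) i))
      × (∀ j t → Lim (λ c → μ (ξ c) j t) top)
      × (∀ j i → Lim (λ c → s' (ξ c) j i) (lookup (m' (M U j)) i))

module Submission where

-- Both directions rest on the affine structure of the two systems: the
-- difference of two characteristic solutions is homogeneous, and a
-- characteristic solution plus any multiple of a homogeneous one is again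
-- characteristic.
--   (⇒) For a large solution sequence ξ, each of the finitely many
--       unbounded coordinates eventually exceeds its value in ξ 0, so some
--       ξ c exceeds ξ 0 on all of them; then ξ 0 solves (i) and ξ c − ξ 0
--       solves (ii).
--   (⇐) Given an integer solution A and a positive homogeneous H, bound all
--       entries of A and all denominators of H by K and put D = K!.  Then
--       ξ c = A + (c + K)·D·H is natural-valued, non-decreasing, constant on
--       fixed coordinates and unbounded on the others.

open import Defs
open import Data.Integer using (ℤ)
open import Data.Rational using (ℚ)
open import Data.Product using (Σ; _×_)
open import Function.Bundles using (_⇔_; mk⇔)

open import Data.Nat as ℕ using (ℕ; zero; suc; _≤_; _<_; _∸_; _⊔_; _!; z≤n; s≤s)
import Data.Nat.Properties as ℕP
open import Data.Nat.Divisibility using (_∣_; divides; ∣-trans; m∣m*n; m≤n⇒m!∣n!)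
open import Data.Integer as ℤ using (+_; -[1+_])
import Data.Integer.Properties as ℤP
open import Data.Rational as ℚ using (0ℚ; 1ℚ; mkℚ; ↥_; ↧ₙ_)
import Data.Rational.Properties as ℚP
import Data.Rational.Unnormalised as ℚᵘ
import Data.Rational.Unnormalised.Properties as ℚᵘP
import Data.Nat.Coprimality as Coprime
open import Data.Rational.Solver using (module +-*-Solver)
open import Data.Fin using (Fin; zero; suc; _≟_; inject₁)
open import Data.Vec using (lookup)
open import Data.Bool using (Bool; true; false; if_then_else_)
open import Data.Product using (_,_; proj₁; proj₂)
open import Relation.Nullary.Decidable using (⌊_⌋; yes; no)
open import Relation.Nullary.Negation using (contradiction)
open import Relation.Binary.PropositionalEquality
open +-*-Solver using (solve; _:+_; _:*_; :-_; con; _:=_)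
open import Algebra.Properties.Group ℚP.+-0-group using (∙-cancelʳ)

-- ℤ→ℚ is an injective ring homomorphism.  We compute through fromℤ, the
-- embedding n ↦ n/1 written directly in normal form (no gcd computation).
module Embedding where
  fromℤ : ℤ → ℚ
  fromℤ z = mkℚ z 0 (Coprime.sym (Coprime.1-coprimeTo _))

  ℤ→ℚ≡fromℤ : ∀ z → ℤ→ℚ z ≡ fromℤ z
  ℤ→ℚ≡fromℤ z = ℚP.↥p/↧p≡p (fromℤ z)

  fromℤ-+ : ∀ a b → fromℤ (a ℤ.+ b) ≡ fromℤ a ℚ.+ fromℤ b
  fromℤ-+ a b = ℚP.toℚᵘ-injective
    (ℚᵘP.≃-trans (ℚᵘ.*≡* eq) (ℚᵘP.≃-sym (ℚP.toℚᵘ-homo-+ (fromℤ a) (fromℤ b))))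
    where
    eq : (a ℤ.+ b) ℤ.* + 1 ≡ (a ℤ.* + 1 ℤ.+ b ℤ.* + 1) ℤ.* + 1
    eq = cong (ℤ._* + 1) (cong₂ ℤ._+_ (sym (ℤP.*-identityʳ a)) (sym (ℤP.*-identityʳ b)))

  fromℤ-* : ∀ a b → fromℤ (a ℤ.* b) ≡ fromℤ a ℚ.* fromℤ b
  fromℤ-* a b = ℚP.toℚᵘ-injective
    (ℚᵘP.≃-trans (ℚᵘ.*≡* refl) (ℚᵘP.≃-sym (ℚP.toℚᵘ-homo-* (fromℤ a) (fromℤ b))))

  ℤ→ℚ-+ : ∀ a b → ℤ→ℚ (a ℤ.+ b) ≡ ℤ→ℚ a ℚ.+ ℤ→ℚ b
  ℤ→ℚ-+ a b = trans (ℤ→ℚ≡fromℤ _)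
    (trans (fromℤ-+ a b) (sym (cong₂ ℚ._+_ (ℤ→ℚ≡fromℤ a) (ℤ→ℚ≡fromℤ b))))

  ℤ→ℚ-* : ∀ a b → ℤ→ℚ (a ℤ.* b) ≡ ℤ→ℚ a ℚ.* ℤ→ℚ b
  ℤ→ℚ-* a b = trans (ℤ→ℚ≡fromℤ _)
    (trans (fromℤ-* a b) (sym (cong₂ ℚ._*_ (ℤ→ℚ≡fromℤ a) (ℤ→ℚ≡fromℤ b))))

  ℤ→ℚ-injective : ∀ {a b} → ℤ→ℚ a ≡ ℤ→ℚ b → a ≡ b
  ℤ→ℚ-injective {a} {b} eq = cong ↥_ (trans (sym (ℤ→ℚ≡fromℤ a)) (trans eq (ℤ→ℚ≡fromℤ b)))

  denominator-clears : ∀ q → ℕ→ℚ (↧ₙ q) ℚ.* q ≡ ℤ→ℚ (↥ q)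
  denominator-clears q@(mkℚ n d _) = begin
    ℕ→ℚ (suc d) ℚ.* q    ≡⟨ cong (ℚ._* q) (ℤ→ℚ≡fromℤ (+ suc d)) ⟩
    fromℤ (+ suc d) ℚ.* q ≡⟨ ℚP.toℚᵘ-injective (ℚᵘP.≃-trans (ℚP.toℚᵘ-homo-* (fromℤ (+ suc d)) q) (ℚᵘ.*≡* eq)) ⟩
    fromℤ n               ≡⟨ ℤ→ℚ≡fromℤ n ⟨
    ℤ→ℚ n                 ∎
    where
    open ≡-Reasoning
    eq : (+ suc d ℤ.* n) ℤ.* + 1 ≡ n ℤ.* + (1 ℕ.* suc d)
    eq = trans (ℤP.*-identityʳ _)
        (trans (ℤP.*-comm (+ suc d) n) (cong (λ y → n ℤ.* + y) (sym (ℕP.*-identityˡ (suc d)))))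

  ℕ→ℚ-positive : ∀ d → 0ℚ ℚ.< ℕ→ℚ (suc d)
  ℕ→ℚ-positive d = subst (0ℚ ℚ.<_) (sym (ℤ→ℚ≡fromℤ (+ suc d))) (ℚ.*<* (ℤ.+<+ (s≤s z≤n)))

open Embedding using (ℤ→ℚ-+; ℤ→ℚ-*; ℤ→ℚ-injective; denominator-clears; ℕ→ℚ-positive)

ℕ→ℚ-* : ∀ m n → ℕ→ℚ (m ℕ.* n) ≡ ℕ→ℚ m ℚ.* ℕ→ℚ n
ℕ→ℚ-* m n = trans (cong ℤ→ℚ (ℤP.pos-* m n)) (ℤ→ℚ-* (+ m) (+ n))

positive-numerator : ∀ q → 0ℚ ℚ.< q → Σ ℕ λ k → ↥ q ≡ + suc k
positive-numerator (mkℚ (+ suc k) _ _) _ = k , refl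
positive-numerator (mkℚ (+ 0) _ _) 0<q with () ← ℚ.positive 0<q
positive-numerator (mkℚ -[1+ _ ] _ _) 0<q with () ← ℚ.positive 0<q

nonNegative-numerator : ∀ q → 0ℚ ℚ.≤ q → + ℤ.∣ ↥ q ∣ ≡ ↥ q
nonNegative-numerator (mkℚ (+ _) _ _) _ = refl
nonNegative-numerator (mkℚ -[1+ _ ] _ _) 0≤q with () ← ℚ.nonNegative 0≤q

-1ℚ : ℚ
-1ℚ = ℚ.- 1ℚ

ℕ-difference-positive : ∀ a b → b < a → 0ℚ ℚ.< ℕ→ℚ a ℚ.+ -1ℚ ℚ.* ℕ→ℚ b
ℕ-difference-positive a b b<a = subst (0ℚ ℚ.<_) (sym difference) (ℕ→ℚ-positive d)
  where
  open ≡-Reasoning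
  d = a ∸ suc b
  cancel : ∀ x y → (x ℚ.+ y) ℚ.+ -1ℚ ℚ.* x ≡ y
  cancel = solve 2 (λ x y → (x :+ y) :+ (:- con 1ℚ) :* x := y) refl
  difference : ℕ→ℚ a ℚ.+ -1ℚ ℚ.* ℕ→ℚ b ≡ ℕ→ℚ (suc d)
  difference = begin
    ℕ→ℚ a ℚ.+ -1ℚ ℚ.* ℕ→ℚ b
      ≡⟨ cong (λ y → ℕ→ℚ y ℚ.+ -1ℚ ℚ.* ℕ→ℚ b) (trans (sym (ℕP.m+[n∸m]≡n b<a)) (sym (ℕP.+-suc b d))) ⟩
    ℕ→ℚ (b ℕ.+ suc d) ℚ.+ -1ℚ ℚ.* ℕ→ℚ b
      ≡⟨ cong (λ y → ℤ→ℚ y ℚ.+ -1ℚ ℚ.* ℕ→ℚ b) (ℤP.pos-+ b (suc d)) ⟩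
    ℤ→ℚ (+ b ℤ.+ + suc d) ℚ.+ -1ℚ ℚ.* ℕ→ℚ b
      ≡⟨ cong (ℚ._+ -1ℚ ℚ.* ℕ→ℚ b) (ℤ→ℚ-+ (+ b) (+ suc d)) ⟩
    (ℕ→ℚ b ℚ.+ ℕ→ℚ (suc d)) ℚ.+ -1ℚ ℚ.* ℕ→ℚ b
      ≡⟨ cancel (ℕ→ℚ b) (ℕ→ℚ (suc d)) ⟩
    ℕ→ℚ (suc d) ∎

module Rearrange where
  swap-last : ∀ a b r d → (a ℚ.+ r ℚ.* b) ℚ.+ d ≡ (a ℚ.+ d) ℚ.+ r ℚ.* b
  swap-last = solve 4 (λ a b r d → (a :+ r :* b) :+ d := (a :+ d) :+ r :* b) refl

  distribute : ∀ a b r c d → (a ℚ.+ r ℚ.* b) ℚ.+ (c ℚ.+ r ℚ.* d) ≡ (a ℚ.+ c) ℚ.+ r ℚ.* (b ℚ.+ d)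
  distribute = solve 5 (λ a b r c d → (a :+ r :* b) :+ (c :+ r :* d) := (a :+ c) :+ r :* (b :+ d)) refl

  plus-zero : ∀ a r → a ℚ.+ r ℚ.* 0ℚ ≡ a
  plus-zero = solve 2 (λ a r → a :+ r :* con 0ℚ := a) refl

  shared-cancels : ∀ a b d → a ℚ.+ -1ℚ ℚ.* b ≡ (a ℚ.+ d) ℚ.+ -1ℚ ℚ.* (b ℚ.+ d)
  shared-cancels = solve 3 (λ a b d → a :+ (:- con 1ℚ) :* b := (a :+ d) :+ (:- con 1ℚ) :* (b :+ d)) refl

  self-cancels : ∀ a → a ℚ.+ -1ℚ ℚ.* a ≡ 0ℚ
  self-cancels = solve 1 (λ a → a :+ (:- con 1ℚ) :* a := con 0ℚ) refl

  times-linear : ∀ x y r c → (x ℚ.+ r ℚ.* y) ℚ.* c ≡ x ℚ.* c ℚ.+ r ℚ.* (y ℚ.* c)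
  times-linear = solve 4 (λ x y r c → (x :+ r :* y) :* c := x :* c :+ r :* (y :* c)) refl

open Rearrange

sumℚ-cong : ∀ {m} {f g : Fin m → ℚ} → (∀ t → f t ≡ g t) → sumℚ f ≡ sumℚ g
sumℚ-cong {zero}  _ = refl
sumℚ-cong {suc m} h = cong₂ ℚ._+_ (h zero) (sumℚ-cong (λ t → h (suc t)))

sumℚ-linear : ∀ {m} (f g : Fin m → ℚ) r →
  sumℚ (λ t → f t ℚ.+ r ℚ.* g t) ≡ sumℚ f ℚ.+ r ℚ.* sumℚ g
sumℚ-linear {zero}  f g r = sym (plus-zero 0ℚ r)
sumℚ-linear {suc m} f g r =
  trans (cong (f zero ℚ.+ r ℚ.* g zero ℚ.+_) (sumℚ-linear (λ t → f (suc t)) (λ t → g (suc t)) r))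
        (distribute (f zero) (g zero) r _ _)

sumℚ-linear-in : ∀ {m} (φ : Fin m → ℚ → ℚ) →
  (∀ t x y r → φ t (x ℚ.+ r ℚ.* y) ≡ φ t x ℚ.+ r ℚ.* φ t y) →
  ∀ (f g : Fin m → ℚ) r →
  sumℚ (λ t → φ t (f t ℚ.+ r ℚ.* g t)) ≡ sumℚ (λ t → φ t (f t)) ℚ.+ r ℚ.* sumℚ (λ t → φ t (g t))
sumℚ-linear-in φ φ-linear f g r =
  trans (sumℚ-cong (λ t → φ-linear t (f t) (g t) r)) (sumℚ-linear (λ t → φ t (f t)) (λ t → φ t (g t)) r)

select-linear : ∀ (b : Bool) x y r →
  (if b then x ℚ.+ r ℚ.* y else 0ℚ) ≡ (if b then x else 0ℚ) ℚ.+ r ℚ.* (if b then y else 0ℚ)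
select-linear true  x y r = refl
select-linear false x y r = sym (plus-zero 0ℚ r)

e-sym : ∀ {m} (u v : Fin m) → e u v ≡ e v u
e-sym u v with u ≟ v | v ≟ u
... | yes _   | yes _   = refl
... | no _    | no _    = refl
... | yes u≡v | no v≢u  = contradiction (sym u≡v) v≢u
... | no u≢v  | yes v≡u = contradiction (sym v≡u) u≢v

module Flow (V : VAS) where
  open VAS V

  inflow outflow : (G : RGraph V) → (Fin (nT G) → ℚ) → Fin (nQ G) → ℚ
  inflow  G μ p = sumℚ (λ t → if ⌊ tgt G t ≟ p ⌋ then μ t else 0ℚ)
  outflow G μ p = sumℚ (λ t → if ⌊ src G t ≟ p ⌋ then μ t else 0ℚ)

  Balanced : (G : RGraph V) → (Fin (nT G) → ℚ) → Set
  Balanced G μ = ∀ p → inflow G μ p ≡ outflow G μ p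

  χ-loop⇒balanced : ∀ G q μ → χ V G q q μ → Balanced G μ
  χ-loop⇒balanced G q μ h p =
    ∙-cancelʳ (e q p) (inflow G μ p) (outflow G μ p) (trans (h p) (cong (outflow G μ p ℚ.+_) (e-sym p q)))

  balanced⇒χ-loop : ∀ G q μ → Balanced G μ → χ V G q q μ
  balanced⇒χ-loop G q μ h p = cong₂ ℚ._+_ (h p) (e-sym q p)

  module _ (G : RGraph V) (μA μB : Fin (nT G) → ℚ) (r : ℚ) where
    private
      μ+rμ : Fin (nT G) → ℚ
      μ+rμ t = μA t ℚ.+ r ℚ.* μB t

    inflow-linear : ∀ p → inflow G μ+rμ p ≡ inflow G μA p ℚ.+ r ℚ.* inflow G μB p
    inflow-linear p =
      sumℚ-linear-in (λ t z → if ⌊ tgt G t ≟ p ⌋ then z else 0ℚ) (λ t → select-linear ⌊ tgt G t ≟ p ⌋) μA μB r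

    outflow-linear : ∀ p → outflow G μ+rμ p ≡ outflow G μA p ℚ.+ r ℚ.* outflow G μB p
    outflow-linear p =
      sumℚ-linear-in (λ t z → if ⌊ src G t ≟ p ⌋ then z else 0ℚ) (λ t → select-linear ⌊ src G t ≟ p ⌋) μA μB r

    effect-linear : ∀ i → effect V G μ+rμ i ≡ effect V G μA i ℚ.+ r ℚ.* effect V G μB i
    effect-linear i = sumℚ-linear-in (λ t z → z ℚ.* δ-entry t) (λ t x y r → times-linear x y r (δ-entry t)) μA μB r
      where
      δ-entry : Fin (nT G) → ℚ
      δ-entry t = ℤ→ℚ (lookup (δ (lab G t)) i)

module Affine (V : VAS) (U : MRGS V) where
  open VAS V
  open Flow V

  _⊕_·_ : Assignment V U ℚ → ℚ → Assignment V U ℚ → Assignment V U ℚ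
  A ⊕ r · B = record
    { s  = λ j i → s A j i ℚ.+ r ℚ.* s B j i
    ; μ  = λ j t → μ A j t ℚ.+ r ℚ.* μ B j t
    ; s' = λ j i → s' A j i ℚ.+ r ℚ.* s' B j i }

  char+hom : ∀ A r B → IsCharSol V U A → IsHomSol V U B → IsCharSol V U (A ⊕ r · B)
  char+hom A r B (glueA , runA , fixA , fixA' , χA) (glueB , runB , fixB , fixB' , χB) =
    glue , run , fix , fix' , kirchhoff
    where
    open ≡-Reasoning
    glue : ∀ j i → (s' A (inject₁ j) i ℚ.+ r ℚ.* s' B (inject₁ j) i) ℚ.+ ℤ→ℚ (lookup (δ (a U j)) i)
                 ≡ s A (suc j) i ℚ.+ r ℚ.* s B (suc j) i
    glue j i = trans (swap-last (s' A (inject₁ j) i) (s' B (inject₁ j) i) r (ℤ→ℚ (lookup (δ (a U j)) i))) (cong₂ (λ x y → x ℚ.+ r ℚ.* y) (glueA j i) (glueB j i))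

    run : ∀ j i → (s A j i ℚ.+ r ℚ.* s B j i) ℚ.+ effect V (G (M U j)) (μ (A ⊕ r · B) j) i
                ≡ s' A j i ℚ.+ r ℚ.* s' B j i
    run j i = begin
      (s A j i ℚ.+ r ℚ.* s B j i) ℚ.+ effect V (G (M U j)) (μ (A ⊕ r · B) j) i
        ≡⟨ cong (s A j i ℚ.+ r ℚ.* s B j i ℚ.+_) (effect-linear (G (M U j)) (μ A j) (μ B j) r i) ⟩
      (s A j i ℚ.+ r ℚ.* s B j i) ℚ.+ (effect V (G (M U j)) (μ A j) i ℚ.+ r ℚ.* effect V (G (M U j)) (μ B j) i)
        ≡⟨ distribute (s A j i) (s B j i) r _ _ ⟩
      (s A j i ℚ.+ effect V (G (M U j)) (μ A j) i) ℚ.+ r ℚ.* (s B j i ℚ.+ effect V (G (M U j)) (μ B j) i)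
        ≡⟨ cong₂ (λ x y → x ℚ.+ r ℚ.* y) (runA j i) (runB j i) ⟩
      s' A j i ℚ.+ r ℚ.* s' B j i ∎

    fix : ∀ j i v → lookup (m (M U j)) i ≡ fin v → s A j i ℚ.+ r ℚ.* s B j i ≡ ℕ→ℚ v
    fix j i v eq = trans (cong₂ (λ x y → x ℚ.+ r ℚ.* y) (fixA j i v eq) (fixB j i v eq)) (plus-zero (ℕ→ℚ v) r)

    fix' : ∀ j i v → lookup (m' (M U j)) i ≡ fin v → s' A j i ℚ.+ r ℚ.* s' B j i ≡ ℕ→ℚ v
    fix' j i v eq = trans (cong₂ (λ x y → x ℚ.+ r ℚ.* y) (fixA' j i v eq) (fixB' j i v eq)) (plus-zero (ℕ→ℚ v) r)

    kirchhoff : ∀ j → χ V (G (M U j)) (x (M U j)) (x' (M U j)) (μ (A ⊕ r · B) j)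
    kirchhoff j p = begin
      inflow Gj μ+rμ p ℚ.+ e x₀ p
        ≡⟨ cong (ℚ._+ e x₀ p) (inflow-linear Gj (μ A j) (μ B j) r p) ⟩
      (inflow Gj (μ A j) p ℚ.+ r ℚ.* inflow Gj (μ B j) p) ℚ.+ e x₀ p
        ≡⟨ swap-last (inflow Gj (μ A j) p) (inflow Gj (μ B j) p) r (e x₀ p) ⟩
      (inflow Gj (μ A j) p ℚ.+ e x₀ p) ℚ.+ r ℚ.* inflow Gj (μ B j) p
        ≡⟨ cong₂ (λ x y → x ℚ.+ r ℚ.* y) (χA j p) (χ-loop⇒balanced Gj x₀ (μ B j) (χB j) p) ⟩
      (outflow Gj (μ A j) p ℚ.+ e p x₁) ℚ.+ r ℚ.* outflow Gj (μ B j) p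
        ≡⟨ swap-last (outflow Gj (μ A j) p) (outflow Gj (μ B j) p) r (e p x₁) ⟨
      (outflow Gj (μ A j) p ℚ.+ r ℚ.* outflow Gj (μ B j) p) ℚ.+ e p x₁
        ≡⟨ cong (ℚ._+ e p x₁) (outflow-linear Gj (μ A j) (μ B j) r p) ⟨
      outflow Gj μ+rμ p ℚ.+ e p x₁ ∎
      where
      Gj = G (M U j)
      x₀ = x (M U j)
      x₁ = x' (M U j)
      μ+rμ = μ (A ⊕ r · B) j

  char-char : ∀ A B → IsCharSol V U A → IsCharSol V U B → IsHomSol V U (A ⊕ -1ℚ · B)
  char-char A B (glueA , runA , fixA , fixA' , χA) (glueB , runB , fixB , fixB' , χB) =
    glue , run , fix , fix' , kirchhoff
    where
    open ≡-Reasoning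

    glue : ∀ j i → s' A (inject₁ j) i ℚ.+ -1ℚ ℚ.* s' B (inject₁ j) i ≡ s A (suc j) i ℚ.+ -1ℚ ℚ.* s B (suc j) i
    glue j i = trans (shared-cancels (s' A (inject₁ j) i) (s' B (inject₁ j) i) (ℤ→ℚ (lookup (δ (a U j)) i))) (cong₂ (λ x y → x ℚ.+ -1ℚ ℚ.* y) (glueA j i) (glueB j i))

    run : ∀ j i → (s A j i ℚ.+ -1ℚ ℚ.* s B j i) ℚ.+ effect V (G (M U j)) (μ (A ⊕ -1ℚ · B) j) i
                ≡ s' A j i ℚ.+ -1ℚ ℚ.* s' B j i
    run j i = begin
      (s A j i ℚ.+ -1ℚ ℚ.* s B j i) ℚ.+ effect V (G (M U j)) (μ (A ⊕ -1ℚ · B) j) i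
        ≡⟨ cong (s A j i ℚ.+ -1ℚ ℚ.* s B j i ℚ.+_) (effect-linear (G (M U j)) (μ A j) (μ B j) -1ℚ i) ⟩
      (s A j i ℚ.+ -1ℚ ℚ.* s B j i) ℚ.+ (effect V (G (M U j)) (μ A j) i ℚ.+ -1ℚ ℚ.* effect V (G (M U j)) (μ B j) i)
        ≡⟨ distribute (s A j i) (s B j i) -1ℚ _ _ ⟩
      (s A j i ℚ.+ effect V (G (M U j)) (μ A j) i) ℚ.+ -1ℚ ℚ.* (s B j i ℚ.+ effect V (G (M U j)) (μ B j) i)
        ≡⟨ cong₂ (λ x y → x ℚ.+ -1ℚ ℚ.* y) (runA j i) (runB j i) ⟩
      s' A j i ℚ.+ -1ℚ ℚ.* s' B j i ∎

    fix : ∀ j i v → lookup (m (M U j)) i ≡ fin v → s A j i ℚ.+ -1ℚ ℚ.* s B j i ≡ 0ℚ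
    fix j i v eq = trans (cong₂ (λ x y → x ℚ.+ -1ℚ ℚ.* y) (fixA j i v eq) (fixB j i v eq)) (self-cancels (ℕ→ℚ v))

    fix' : ∀ j i v → lookup (m' (M U j)) i ≡ fin v → s' A j i ℚ.+ -1ℚ ℚ.* s' B j i ≡ 0ℚ
    fix' j i v eq = trans (cong₂ (λ x y → x ℚ.+ -1ℚ ℚ.* y) (fixA' j i v eq) (fixB' j i v eq)) (self-cancels (ℕ→ℚ v))

    kirchhoff : ∀ j → χ V (G (M U j)) (x (M U j)) (x (M U j)) (μ (A ⊕ -1ℚ · B) j)
    kirchhoff j = balanced⇒χ-loop Gj x₀ (μ (A ⊕ -1ℚ · B) j) λ p → begin
      inflow Gj (μ (A ⊕ -1ℚ · B) j) p
        ≡⟨ inflow-linear Gj (μ A j) (μ B j) -1ℚ p ⟩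
      inflow Gj (μ A j) p ℚ.+ -1ℚ ℚ.* inflow Gj (μ B j) p
        ≡⟨ shared-cancels (inflow Gj (μ A j) p) (inflow Gj (μ B j) p) (e x₀ p) ⟩
      (inflow Gj (μ A j) p ℚ.+ e x₀ p) ℚ.+ -1ℚ ℚ.* (inflow Gj (μ B j) p ℚ.+ e x₀ p)
        ≡⟨ cong₂ (λ x y → x ℚ.+ -1ℚ ℚ.* y) (χA j p) (χB j p) ⟩
      (outflow Gj (μ A j) p ℚ.+ e p x₁) ℚ.+ -1ℚ ℚ.* (outflow Gj (μ B j) p ℚ.+ e p x₁)
        ≡⟨ shared-cancels (outflow Gj (μ A j) p) (outflow Gj (μ B j) p) (e p x₁) ⟨
      outflow Gj (μ A j) p ℚ.+ -1ℚ ℚ.* outflow Gj (μ B j) p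
        ≡⟨ outflow-linear Gj (μ A j) (μ B j) -1ℚ p ⟨
      outflow Gj (μ (A ⊕ -1ℚ · B) j) p ∎
      where
      Gj = G (M U j)
      x₀ = x (M U j)
      x₁ = x' (M U j)

  IsCharSol-resp : ∀ A B → (∀ j i → s A j i ≡ s B j i) → (∀ j t → μ A j t ≡ μ B j t) →
                   (∀ j i → s' A j i ≡ s' B j i) → IsCharSol V U A → IsCharSol V U B
  IsCharSol-resp A B s≡ μ≡ s'≡ (glueA , runA , fixA , fixA' , χA) =
    (λ j i → trans (cong (ℚ._+ _) (sym (s'≡ (inject₁ j) i))) (trans (glueA j i) (s≡ (suc j) i))) ,
    (λ j i → trans (cong₂ ℚ._+_ (sym (s≡ j i)) (sumℚ-cong (λ t → cong (ℚ._* _) (sym (μ≡ j t)))))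
                   (trans (runA j i) (s'≡ j i))) ,
    (λ j i v eq → trans (sym (s≡ j i)) (fixA j i v eq)) ,
    (λ j i v eq → trans (sym (s'≡ j i)) (fixA' j i v eq)) ,
    λ j p → trans (cong (ℚ._+ _) (flow-cong tgt j p))
                  (trans (χA j p) (cong (ℚ._+ _) (sym (flow-cong src j p))))
    where
    flow-cong : (end : (G : RGraph V) → Fin (nT G) → Fin (nQ G)) → ∀ j p →
      sumℚ (λ t → if ⌊ end (G (M U j)) t ≟ p ⌋ then μ B j t else 0ℚ)
        ≡ sumℚ (λ t → if ⌊ end (G (M U j)) t ≟ p ⌋ then μ A j t else 0ℚ)
    flow-cong end j p = sumℚ-cong (λ t → cong (λ z → if ⌊ end (G (M U j)) t ≟ p ⌋ then z else 0ℚ) (sym (μ≡ j t)))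

step-monotone : (f : ℕ → ℕ) → (∀ c → f c ≤ f (suc c)) → ∀ {c c'} → c ≤ c' → f c ≤ f c'
step-monotone f grows {c} c≤c' = go (ℕP.≤⇒≤′ c≤c')
  where
  go : ∀ {c'} → c ℕ.≤′ c' → f c ≤ f c'
  go ℕ.≤′-refl     = ℕP.≤-refl
  go (ℕ.≤′-step p) = ℕP.≤-trans (go p) (grows _)

Eventually : (ℕ → Set) → Set
Eventually P = Σ ℕ λ c₀ → ∀ {c} → c₀ ≤ c → P c

eventually-× : ∀ {P Q : ℕ → Set} → Eventually P → Eventually Q → Eventually (λ c → P c × Q c)
eventually-× (c₀ , P-from) (c₁ , Q-from) =
  c₀ ⊔ c₁ , λ le → P-from (ℕP.m⊔n≤o⇒m≤o c₀ c₁ le) , Q-from (ℕP.m⊔n≤o⇒n≤o c₀ c₁ le)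

eventually-∀ : ∀ {m} {P : Fin m → ℕ → Set} → (∀ i → Eventually (P i)) → Eventually (λ c → ∀ i → P i c)
eventually-∀ {zero}  _  = 0 , λ _ ()
eventually-∀ {suc m} ev with eventually-× (ev zero) (eventually-∀ (λ i → ev (suc i)))
... | c₀ , both-from = c₀ , λ { le zero → proj₁ (both-from le) ; le (suc i) → proj₂ (both-from le) i }

eventually-exceeds : ∀ V (f : ℕ → ℕ) → (∀ c → f c ≤ f (suc c)) → Lim V f top →
  Eventually (λ c → f 0 < f c)
eventually-exceeds V f grows unbounded with unbounded (suc (f 0))
... | c₀ , f0<fc₀ = c₀ , λ c₀≤c → ℕP.<-≤-trans f0<fc₀ (step-monotone f grows c₀≤c)

eventually-exceeds-if-top : ∀ V (f : ℕ → ℕ) x → (∀ c → f c ≤ f (suc c)) → Lim V f x →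
  Eventually (λ c → x ≡ top → f 0 < f c)
eventually-exceeds-if-top V f (fin _) _     _   = 0 , λ _ ()
eventually-exceeds-if-top V f top     grows lim with eventually-exceeds V f grows lim
... | c₀ , exceeds-from = c₀ , λ c₀≤c _ → exceeds-from c₀≤c

module Forward (V : VAS) (U : MRGS V) where
  open Affine V U

  _≺_ : Assignment V U ℕ → Assignment V U ℕ → Set
  A ≺ B = (∀ j i → lookup (m (M U j)) i ≡ top → s A j i < s B j i)
        × (∀ j t → μ A j t < μ B j t)
        × (∀ j i → lookup (m' (M U j)) i ≡ top → s' A j i < s' B j i)

  difference-positive : ∀ A B → A ≺ B → Positive V U (mapA V ℕ→ℚ B ⊕ -1ℚ · mapA V ℕ→ℚ A)
  difference-positive A B (s< , μ< , s'<) =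
    (λ j i is-top → ℕ-difference-positive _ _ (s< j i is-top)) ,
    (λ j t → ℕ-difference-positive _ _ (μ< j t)) ,
    (λ j i is-top → ℕ-difference-positive _ _ (s'< j i is-top))

  large⇒solutions : LargeSolutionCondition V U →
    (Σ (Assignment V U ℤ) λ A → IsCharSol V U (mapA V ℤ→ℚ A))
    × (Σ (Assignment V U ℚ) λ A → IsHomSol V U A × Positive V U A)
  large⇒solutions (ξ , char , grows , lim-s , lim-μ , lim-s') =
    (mapA V +_ (ξ 0) , char 0) ,
    (mapA V ℕ→ℚ (ξ c) ⊕ -1ℚ · mapA V ℕ→ℚ (ξ 0) ,
     char-char _ _ (char c) (char 0) ,
     difference-positive (ξ 0) (ξ c) ξ0≺ξc)
    where
    eventually-above : Eventually (λ c → ξ 0 ≺ ξ c)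
    eventually-above =
      eventually-× (eventually-∀ λ j → eventually-∀ λ i →
        eventually-exceeds-if-top V (λ c → s (ξ c) j i) _ (λ c → proj₁ (grows c) j i) (lim-s j i))
      (eventually-× (eventually-∀ λ j → eventually-∀ λ t →
        eventually-exceeds V (λ c → μ (ξ c) j t) (λ c → proj₁ (proj₂ (grows c)) j t) (lim-μ j t))
      (eventually-∀ λ j → eventually-∀ λ i →
        eventually-exceeds-if-top V (λ c → s' (ξ c) j i) _ (λ c → proj₂ (proj₂ (grows c)) j i) (lim-s' j i)))
    c : ℕ
    c = proj₁ eventually-above
    ξ0≺ξc : ξ 0 ≺ ξ c
    ξ0≺ξc = proj₂ eventually-above ℕP.≤-refl

-- a + x for an integer a and a natural x, truncated at 0
offset : ℤ → ℕ → ℕ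
offset (+ p)     x = p ℕ.+ x
offset -[1+ p ] x = x ∸ suc p

offset-≡ : ∀ a {x} → ℤ.∣ a ∣ ≤ x → + offset a x ≡ a ℤ.+ + x
offset-≡ (+ p)     _   = ℤP.pos-+ p _
offset-≡ -[1+ p ] ∣a∣≤x = sym (ℤP.⊖-≥ ∣a∣≤x)

offset-monotone : ∀ a {x x'} → x ≤ x' → offset a x ≤ offset a x'
offset-monotone (+ p)     x≤x' = ℕP.+-monoʳ-≤ p x≤x'
offset-monotone -[1+ p ] x≤x' = ℕP.∸-monoˡ-≤ (suc p) x≤x'

offset-lower-bound : ∀ a x → x ∸ ℤ.∣ a ∣ ≤ offset a x
offset-lower-bound (+ p)     x = ℕP.≤-trans (ℕP.m∸n≤m x p) (ℕP.m≤n+m x p)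
offset-lower-bound -[1+ p ] x = ℕP.≤-refl

divides-factorial : ∀ {d K} → 1 ≤ d → d ≤ K → d ∣ K !
divides-factorial {suc d} _ d≤K = ∣-trans (m∣m*n (d !)) (m≤n⇒m!∣n! d≤K)

module Scale (D : ℕ) where
  scaled : (q : ℚ) → ↧ₙ q ∣ D → ℕ
  scaled q (divides k _) = k ℕ.* ℤ.∣ ↥ q ∣

  scaled-≡ : ∀ q q∣D → 0ℚ ℚ.≤ q → ℕ→ℚ (scaled q q∣D) ≡ ℕ→ℚ D ℚ.* q
  scaled-≡ q (divides k D≡k*den) 0≤q = begin
    ℕ→ℚ (k ℕ.* ℤ.∣ ↥ q ∣)             ≡⟨ ℕ→ℚ-* k _ ⟩
    ℕ→ℚ k ℚ.* ℕ→ℚ ℤ.∣ ↥ q ∣           ≡⟨ cong (λ z → ℕ→ℚ k ℚ.* ℤ→ℚ z) (nonNegative-numerator q 0≤q) ⟩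
    ℕ→ℚ k ℚ.* ℤ→ℚ (↥ q)               ≡⟨ cong (ℕ→ℚ k ℚ.*_) (denominator-clears q) ⟨
    ℕ→ℚ k ℚ.* (ℕ→ℚ (↧ₙ q) ℚ.* q)      ≡⟨ ℚP.*-assoc (ℕ→ℚ k) _ q ⟨
    (ℕ→ℚ k ℚ.* ℕ→ℚ (↧ₙ q)) ℚ.* q      ≡⟨ cong (ℚ._* q) (ℕ→ℚ-* k (↧ₙ q)) ⟨
    ℕ→ℚ (k ℕ.* ↧ₙ q) ℚ.* q            ≡⟨ cong (λ z → ℕ→ℚ z ℚ.* q) D≡k*den ⟨
    ℕ→ℚ D ℚ.* q                        ∎
    where open ≡-Reasoning

  scaled-zero : ∀ q q∣D → q ≡ 0ℚ → scaled q q∣D ≡ 0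
  scaled-zero q (divides k _) refl = ℕP.*-zeroʳ k

  scaled-positive : .{{ℕ.NonZero D}} → ∀ q q∣D → 0ℚ ℚ.< q → ℕ.NonZero (scaled q q∣D)
  scaled-positive q (divides zero D≡0) _ = contradiction D≡0 (ℕ.≢-nonZero⁻¹ D)
  scaled-positive q (divides (suc k) _) 0<q with positive-numerator q 0<q
  ... | n , ↥q≡1+n rewrite ↥q≡1+n = _

-- How a coordinate of the large solution sequence behaves: fixed at v (the
-- integer solution is v there and the homogeneous solution vanishes) or
-- growing (the homogeneous solution is positive there).
data Regime (a : ℤ) (q : ℚ) : ℕ⊤ → Set where
  fixed   : ∀ {v} → a ≡ + v → q ≡ 0ℚ → Regime a q (fin v)
  growing : 0ℚ ℚ.< q → Regime a q top

coefficient : ℕ → ℕ → ℚ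
coefficient K c = ℕ→ℚ (c ℕ.+ K) ℚ.* ℕ→ℚ (K !)

module Coordinate (K : ℕ) (a : ℤ) (q : ℚ) (∣a∣≤K : ℤ.∣ a ∣ ≤ K) (den≤K : ↧ₙ q ≤ K) where
  open Scale (K !)

  private
    instance
      K!≢0 : ℕ.NonZero (K !)
      K!≢0 = K ℕP.!≢0

    q∣K! : ↧ₙ q ∣ K !
    q∣K! = divides-factorial (s≤s z≤n) den≤K

    w : ℕ
    w = scaled q q∣K!

  value : ℕ → ℕ
  value c = offset a ((c ℕ.+ K) ℕ.* w)

  value-grows : ∀ c → value c ≤ value (suc c)
  value-grows c = offset-monotone a (ℕP.*-monoˡ-≤ w (ℕP.n≤1+n (c ℕ.+ K)))

  -- In the growing regime w ≥ 1, so (c + K)·w ≥ c + K ≥ c + ∣a∣.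
  large-if-growing : 0ℚ ℚ.< q → ∀ c → c ℕ.+ K ≤ (c ℕ.+ K) ℕ.* w
  large-if-growing 0<q c = ℕP.m≤m*n (c ℕ.+ K) w {{scaled-positive q q∣K! 0<q}}

  value-unbounded : 0ℚ ℚ.< q → ∀ c → c ≤ value c
  value-unbounded 0<q c = begin
    c                             ≡⟨ ℕP.m+n∸n≡m c K ⟨
    c ℕ.+ K ∸ K                   ≤⟨ ℕP.∸-monoˡ-≤ K (large-if-growing 0<q c) ⟩
    (c ℕ.+ K) ℕ.* w ∸ K           ≤⟨ ℕP.∸-monoʳ-≤ _ ∣a∣≤K ⟩
    (c ℕ.+ K) ℕ.* w ∸ ℤ.∣ a ∣     ≤⟨ offset-lower-bound a _ ⟩
    value c                       ∎
    where open ℕP.≤-Reasoning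

  value-fixed : ∀ {v} → a ≡ + v → q ≡ 0ℚ → ∀ c → value c ≡ v
  value-fixed refl q≡0 c rewrite scaled-zero q q∣K! q≡0 | ℕP.*-zeroʳ (c ℕ.+ K) = ℕP.+-identityʳ _

  value-≡ : ∀ {x} → Regime a q x → ∀ c → ℕ→ℚ (value c) ≡ ℤ→ℚ a ℚ.+ coefficient K c ℚ.* q
  value-≡ (fixed {v} a≡v q≡0) c = begin
    ℕ→ℚ (value c)                        ≡⟨ cong ℕ→ℚ (value-fixed a≡v q≡0 c) ⟩
    ℕ→ℚ v                                ≡⟨ plus-zero (ℕ→ℚ v) (coefficient K c) ⟨
    ℕ→ℚ v ℚ.+ coefficient K c ℚ.* 0ℚ     ≡⟨ cong₂ (λ y z → ℤ→ℚ y ℚ.+ coefficient K c ℚ.* z) a≡v q≡0 ⟨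
    ℤ→ℚ a ℚ.+ coefficient K c ℚ.* q      ∎
    where open ≡-Reasoning
  value-≡ (growing 0<q) c = begin
    ℕ→ℚ (value c)                                  ≡⟨ cong ℤ→ℚ (offset-≡ a ∣a∣≤X) ⟩
    ℤ→ℚ (a ℤ.+ + X)                                ≡⟨ ℤ→ℚ-+ a (+ X) ⟩
    ℤ→ℚ a ℚ.+ ℕ→ℚ X                                ≡⟨ cong (ℤ→ℚ a ℚ.+_) (ℕ→ℚ-* (c ℕ.+ K) w) ⟩
    ℤ→ℚ a ℚ.+ ℕ→ℚ (c ℕ.+ K) ℚ.* ℕ→ℚ w              ≡⟨ cong (λ z → ℤ→ℚ a ℚ.+ ℕ→ℚ (c ℕ.+ K) ℚ.* z) (scaled-≡ q q∣K! (ℚP.<⇒≤ 0<q)) ⟩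
    ℤ→ℚ a ℚ.+ ℕ→ℚ (c ℕ.+ K) ℚ.* (ℕ→ℚ (K !) ℚ.* q) ≡⟨ cong (ℤ→ℚ a ℚ.+_) (ℚP.*-assoc (ℕ→ℚ (c ℕ.+ K)) _ q) ⟨
    ℤ→ℚ a ℚ.+ coefficient K c ℚ.* q                ∎
    where
    open ≡-Reasoning
    X = (c ℕ.+ K) ℕ.* w
    ∣a∣≤X : ℤ.∣ a ∣ ≤ X
    ∣a∣≤X = ℕP.≤-trans ∣a∣≤K (ℕP.≤-trans (ℕP.m≤n+m K c) (large-if-growing 0<q c))

  value-lim : ∀ V {x} → Regime a q x → Lim V value x
  value-lim V (fixed a≡v q≡0) = (λ c → ℕP.≤-reflexive (value-fixed a≡v q≡0 c)) , 0 , value-fixed a≡v q≡0 0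
  value-lim V (growing 0<q)   = λ b → b , value-unbounded 0<q b

module Backward (V : VAS) (U : MRGS V) where
  open VAS V
  open Affine V U

  Every : ∀ {X : Set} → (X → Set) → Assignment V U X → Set
  Every P A = (∀ j i → P (s A j i)) × (∀ j t → P (μ A j t)) × (∀ j i → P (s' A j i))

  bounded : ∀ {X : Set} (size : X → ℕ) (A : Assignment V U X) → Eventually (λ K → Every (λ y → size y ≤ K) A)
  bounded size A =
    eventually-× (eventually-∀ λ j → eventually-∀ λ i → at-least (size (s A j i)))
    (eventually-× (eventually-∀ λ j → eventually-∀ λ t → at-least (size (μ A j t)))
                  (eventually-∀ λ j → eventually-∀ λ i → at-least (size (s' A j i))))
    where
    at-least : ∀ b → Eventually (b ≤_)
    at-least b = b , λ b≤K → b≤K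

  solutions⇒large :
    (Σ (Assignment V U ℤ) λ A → IsCharSol V U (mapA V ℤ→ℚ A))
    × (Σ (Assignment V U ℚ) λ A → IsHomSol V U A × Positive V U A) →
    LargeSolutionCondition V U
  solutions⇒large ((A , charA) , (H , homH , pos-s , pos-μ , pos-s')) =
    ξ , char , grows , (λ j i → S.value-lim j i V (regime-s j i)) ,
    (λ j t → Tr.value-lim j t V (growing (pos-μ j t))) , (λ j i → S'.value-lim j i V (regime-s' j i))
    where
    bounds : Eventually (λ K → Every (λ a → ℤ.∣ a ∣ ≤ K) A × Every (λ q → ↧ₙ q ≤ K) H)
    bounds = eventually-× (bounded ℤ.∣_∣ A) (bounded ↧ₙ_ H)

    K : ℕ
    K = proj₁ bounds

    bounds-K : Every (λ a → ℤ.∣ a ∣ ≤ K) A × Every (λ q → ↧ₙ q ≤ K) H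
    bounds-K = proj₂ bounds ℕP.≤-refl

    module S (j : Fin (suc (k U))) (i : Fin n) =
      Coordinate K (s A j i) (s H j i) (proj₁ (proj₁ bounds-K) j i) (proj₁ (proj₂ bounds-K) j i)
    module Tr (j : Fin (suc (k U))) (t : Fin (nT (G (M U j)))) =
      Coordinate K (μ A j t) (μ H j t) (proj₁ (proj₂ (proj₁ bounds-K)) j t) (proj₁ (proj₂ (proj₂ bounds-K)) j t)
    module S' (j : Fin (suc (k U))) (i : Fin n) =
      Coordinate K (s' A j i) (s' H j i) (proj₂ (proj₂ (proj₁ bounds-K)) j i) (proj₂ (proj₂ (proj₂ bounds-K)) j i)

    ξ : ℕ → Assignment V U ℕ
    ξ c = record
      { s  = λ j i → S.value j i c
      ; μ  = λ j t → Tr.value j t c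
      ; s' = λ j i → S'.value j i c }

    grows : ∀ c → _≤A_ V (ξ c) (ξ (suc c))
    grows c = (λ j i → S.value-grows j i c) , (λ j t → Tr.value-grows j t c) , (λ j i → S'.value-grows j i c)

    regime-s : ∀ j i → Regime (s A j i) (s H j i) (lookup (m (M U j)) i)
    regime-s j i with lookup (m (M U j)) i in eq
    ... | fin v = fixed (ℤ→ℚ-injective (proj₁ (proj₂ (proj₂ charA)) j i v eq)) (proj₁ (proj₂ (proj₂ homH)) j i v eq)
    ... | top   = growing (pos-s j i eq)

    regime-s' : ∀ j i → Regime (s' A j i) (s' H j i) (lookup (m' (M U j)) i)
    regime-s' j i with lookup (m' (M U j)) i in eq
    ... | fin v = fixed (ℤ→ℚ-injective (proj₁ (proj₂ (proj₂ (proj₂ charA))) j i v eq)) (proj₁ (proj₂ (proj₂ (proj₂ homH))) j i v eq)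
    ... | top   = growing (pos-s' j i eq)

    char : ∀ c → IsCharSol V U (mapA V ℕ→ℚ (ξ c))
    char c = IsCharSol-resp (mapA V ℤ→ℚ A ⊕ coefficient K c · H) (mapA V ℕ→ℚ (ξ c))
      (λ j i → sym (S.value-≡ j i (regime-s j i) c))
      (λ j t → sym (Tr.value-≡ j t (growing (pos-μ j t)) c))
      (λ j i → sym (S'.value-≡ j i (regime-s' j i) c))
      (char+hom (mapA V ℤ→ℚ A) (coefficient K c) H charA homH)

lemma3p5 : (V : VAS) (U : MRGS V) →
    LargeSolutionCondition V U ⇔
    ((Σ (Assignment V U ℤ) λ A → IsCharSol V U (mapA V ℤ→ℚ A))
    × (Σ (Assignment V U ℚ) λ A → IsHomSol V U A × Positive V U A))
lemma3p5 V U = mk⇔ (Forward.large⇒solutions V U) (Backward.solutions⇒large V U)
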